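{- Let $T$ be a tree of order $n\ge 4$. Then $\gamma_{tc}(M(T))=2n-2$ if and only if $T$ is isomorphic to the star $K_{1,n-1}$.
   Context: All graphs are finite, simple and undirected. For a graph $H$, a set $D\subseteq V(H)$ is a total dominating set if every vertex of $H$ has a neighbor in $D$. A set $D\subseteq V(H)$ is a total outer-connected dominating set of $H$ if $D$ is a total dominating set and the induced subgraph $H[V(H)\setminus D]$ is connected; $\gamma_{tc}(H)$ denotes the minimum cardinality of a total outer-connected dominating set of $H$. The middle graph $M(G)$ of a graph $G$ has vertex set $V(G)\cup E(G)$, where two elements $x,y$ are adjacent iff either $x,y\in E(G)$ are edges of $G$ sharing an endpoint, or one of them is a vertex of $G$ and the other is an edge of $G$ incident to it. -}

module Defs where

open import Data.Nat using (ℕ; _≤_; _<_)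
open import Data.Bool using (Bool; true; false; T; _xor_)
open import Data.Fin using (Fin; toℕ)
import Data.Fin as F
open import Data.Product using (Σ; ∃; ∃-syntax; _×_; _,_)
open import Data.Sum using (_⊎_; inj₁; inj₂)
open import Data.Empty using (⊥)
open import Data.Unit using (⊤)
open import Data.List using (List; []; _∷_; length; _∷ʳ_)
open import Data.List.Membership.Propositional using (_∈_; _∉_)
open import Data.List.Relation.Unary.Unique.Propositional using (Unique)
open import Data.List.Relation.Unary.Linked using (Linked)
open import Relation.Nullary using (¬_)
open import Relation.Binary.PropositionalEquality using (_≡_; _≢_)
open import Function.Bundles using (_↔_; Inverse)
import Data.Nat as N

record Graph (V : Set) : Set₁ where
  field
    Adj    : V → V → Set
    Adj-sym    : ∀ {x y} → Adj x y → Adj y x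
    Adj-irrefl : ∀ {x} → ¬ Adj x x
open Graph public

data WalkIn {V : Set} (G : Graph V) (P : V → Set) : V → V → Set where
  here : ∀ {x} → P x → WalkIn G P x x
  step : ∀ {x y z} → P x → Adj G x y → WalkIn G P y z → WalkIn G P x z

Connected : ∀ {V} → Graph V → Set
Connected G = ∀ x y → WalkIn G (λ _ → ⊤) x y

-- A cycle x, y₁, …, yₖ, z (k ≥ 1, so length ≥ 3) of distinct vertices.
IsCycle : ∀ {V} → Graph V → V → List V → V → Set
IsCycle G x ys z =
  Unique (x ∷ (ys ∷ʳ z)) × 1 ≤ length ys ×
  Linked (Adj G) (x ∷ (ys ∷ʳ z)) × Adj G z x

Acyclic : ∀ {V} → Graph V → Set
Acyclic {V} G = ∀ (x : V) ys z → ¬ IsCycle G x ys z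

IsTree : ∀ {V} → Graph V → Set
IsTree G = Connected G × Acyclic G

record FinGraph (n : ℕ) : Set where
  field
    adj       : Fin n → Fin n → Bool
    adj-sym   : ∀ i j → adj i j ≡ adj j i
    adj-irr   : ∀ i → adj i i ≡ false
open FinGraph public

toGraph : ∀ {n} → FinGraph n → Graph (Fin n)
toGraph G = record
  { Adj = λ i j → T (adj G i j)
  ; Adj-sym = λ {i} {j} p → sym' i j p
  ; Adj-irrefl = λ {i} p → irr' i p }
  where
  open import Relation.Binary.PropositionalEquality using (subst)
  sym' : ∀ i j → T (adj G i j) → T (adj G j i)
  sym' i j p = subst T (adj-sym G i j) p
  irr' : ∀ i → ¬ T (adj G i i)
  irr' i p with adj G i i | adj-irr G i
  ... | false | _ = p

Edge : ∀ {n} → FinGraph n → Set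
Edge {n} G = Σ (Fin n) λ i → Σ (Fin n) λ j → (i F.< j) × T (adj G i j)

Incident : ∀ {n} {G : FinGraph n} → Fin n → Edge G → Set
Incident v (i , j , _) = (v ≡ i) ⊎ (v ≡ j)

ShareEnd : ∀ {n} {G : FinGraph n} → Edge G → Edge G → Set
ShareEnd {G = G} e f = ∃[ v ] (Incident {G = G} v e × Incident {G = G} v f)

MAdj : ∀ {n} (G : FinGraph n) → (Fin n ⊎ Edge G) → (Fin n ⊎ Edge G) → Set
MAdj G (inj₁ u) (inj₁ v) = ⊥
MAdj G (inj₁ u) (inj₂ e) = Incident {G = G} u e
MAdj G (inj₂ e) (inj₁ v) = Incident {G = G} v e
MAdj G (inj₂ e) (inj₂ f) = (e ≢ f) × ShareEnd {G = G} e f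

Middle : ∀ {n} (G : FinGraph n) → Graph (Fin n ⊎ Edge G)
Middle G = record { Adj = MAdj G ; Adj-sym = msym ; Adj-irrefl = mirr }
  where
  open import Relation.Binary.PropositionalEquality using (sym)
  msym : ∀ {x y} → MAdj G x y → MAdj G y x
  msym {inj₁ u} {inj₂ e} p = p
  msym {inj₂ e} {inj₁ v} p = p
  msym {inj₂ e} {inj₂ f} (ne , v , a , b) = (λ q → ne (sym q)) , v , b , a
  mirr : ∀ {x} → ¬ MAdj G x x
  mirr {inj₂ e} (ne , _) = ne Relation.Binary.PropositionalEquality.refl

-- Total outer-connected domination. A vertex set D is represented by
-- a duplicate-free list; |D| = length D.

IsTotalDominating : ∀ {V} → Graph V → List V → Set
IsTotalDominating G D = ∀ v → ∃[ d ] (d ∈ D × Adj G v d)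

IsTOCDS : ∀ {V} → Graph V → List V → Set
IsTOCDS G D =
  Unique D × IsTotalDominating G D ×
  (∀ x y → x ∉ D → y ∉ D → WalkIn G (λ v → v ∉ D) x y)

γtc-is : ∀ {V} → Graph V → ℕ → Set
γtc-is G k =
  (∃[ D ] (IsTOCDS G D × length D ≡ k)) ×
  (∀ D → IsTOCDS G D → k ≤ length D)

isZero : ∀ {n} → Fin n → Bool
isZero i = toℕ i N.≡ᵇ 0

StarAdj : ∀ {n} → Fin n → Fin n → Bool
StarAdj i j = isZero i xor isZero j

IsoToStar : ∀ {n} → FinGraph n → Set
IsoToStar {n} G =
  Σ (Fin n ↔ Fin n) λ f → ∀ i j →
    adj G i j ≡ StarAdj (Inverse.to f i) (Inverse.to f j)

module Submission where

-- If T is not a star it has an edge uv with both u and v of degree at least 2;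
-- deleting the middle vertices e = uv and u from M(T) leaves a total
-- outer-connected dominating set, of size n + (n - 1) - 2 < 2n - 2 because a
-- tree has n - 1 edges. If T is a star with centre c, every edge is the only
-- edge at its leaf, so every total dominating set of M(T) contains all n - 1
-- edges; then a vertex of T outside such a set has all its neighbours inside
-- it, so outer-connectedness leaves at most one vertex of T outside, giving
-- at least 2n - 2 elements, which M(T) minus the vertex c attains.

open import Data.Bool using (T; false; _xor_)
import Data.Bool.Properties as BP
open import Data.Empty using (⊥; ⊥-elim)
open import Data.Fin as F using (Fin)
import Data.Fin.Permutation as Perm
import Data.Fin.Properties as FP
open import Data.List
  using (List; []; _∷_; length; _++_; _∷ʳ_; [_]; map; filter; allFin; concatMap; cartesianProduct; deduplicate)
import Data.List.Properties as LP
open import Data.List.Membership.Propositional using (_∈_; _∉_; lose; find)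
import Data.List.Membership.Propositional.Properties as MP
open import Data.List.Membership.DecPropositional using () renaming (_∈?_ to member?)
open import Data.List.Relation.Binary.Subset.Propositional using (_⊆_)
open import Data.List.Relation.Unary.Any using (Any; here; there)
import Data.List.Relation.Unary.All as All
import Data.List.Relation.Unary.All.Properties as AllP
open import Data.List.Relation.Unary.AllPairs using ([]; _∷_)
open import Data.List.Relation.Unary.Linked using (Linked; []; [-]; _∷_)
import Data.List.Relation.Unary.Linked as Lk
open import Data.List.Relation.Unary.Unique.Propositional using (Unique)
import Data.List.Relation.Unary.Unique.Propositional.Properties as UP
import Data.List.Relation.Unary.Unique.DecPropositional.Properties as UDP
open import Data.Nat using (ℕ; zero; suc; _+_; _*_; _∸_; _≤_; _<_; z≤n; s≤s)
import Data.Nat.Properties as ℕP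
open import Data.Product using (Σ; ∃; _×_; _,_; proj₁; proj₂)
open import Data.Sum using (_⊎_; inj₁; inj₂)
import Data.Sum.Properties as SP
open import Function using (_∘_; id)
open import Function.Bundles using (_⇔_; _↔_; Equivalence; Inverse; mk⇔)
open import Level using (0ℓ)
open import Relation.Binary.Construct.Closure.ReflexiveTransitive using (Star; ε; _◅_; _◅◅_)
import Relation.Binary.Construct.Closure.ReflexiveTransitive as Star
open import Relation.Binary.Definitions using (DecidableEquality; tri<; tri≈; tri>)
open import Relation.Binary.PropositionalEquality hiding ([_])
open import Relation.Nullary using (¬_; Dec; yes; no; does; ¬?; _×-dec_)
open import Relation.Nullary.Decidable using (decidable-stable)
open import Relation.Unary using (Pred; Decidable)

open import Defs

Unique-++⁻ʳ : ∀ {A : Set} (xs : List A) {ys} → Unique (xs ++ ys) → Unique ys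
Unique-++⁻ʳ []       u       = u
Unique-++⁻ʳ (x ∷ xs) (_ ∷ u) = Unique-++⁻ʳ xs u

Linked-++⁻ʳ : ∀ {A : Set} {R : A → A → Set} (xs : List A) {ys} →
              Linked R (xs ++ ys) → Linked R ys
Linked-++⁻ʳ []           l       = l
Linked-++⁻ʳ (x ∷ [])     [-]     = []
Linked-++⁻ʳ (x ∷ [])     (_ ∷ l) = l
Linked-++⁻ʳ (x ∷ y ∷ xs) (_ ∷ l) = Linked-++⁻ʳ (y ∷ xs) l

Unique⇒length≤ : ∀ {A : Set} {xs ys : List A} → Unique xs → xs ⊆ ys →
                 length xs ≤ length ys
Unique⇒length≤ {xs = []}     _          _   = z≤n
Unique⇒length≤ {xs = x ∷ xs} (x∉ ∷ u) xs⊆ys with MP.∈-∃++ (xs⊆ys (here refl))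
... | as , bs , refl = subst (suc (length xs) ≤_) (sym length-split)
                         (s≤s (Unique⇒length≤ u xs⊆as++bs))
  where
  length-split : length (as ++ x ∷ bs) ≡ suc (length (as ++ bs))
  length-split = begin
    length (as ++ x ∷ bs)        ≡⟨ LP.length-++ as ⟩
    length as + suc (length bs)  ≡⟨ ℕP.+-suc (length as) (length bs) ⟩
    suc (length as + length bs)  ≡⟨ cong suc (LP.length-++ as) ⟨
    suc (length (as ++ bs))      ∎
    where open ≡-Reasoning
  xs⊆as++bs : xs ⊆ as ++ bs
  xs⊆as++bs {z} z∈ with MP.∈-++⁻ as (xs⊆ys (there z∈))
  ... | inj₁ z∈as         = MP.∈-++⁺ˡ z∈as
  ... | inj₂ (here refl)  = ⊥-elim (All.lookup x∉ z∈ refl)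
  ... | inj₂ (there z∈bs) = MP.∈-++⁺ʳ as z∈bs

-- If x reappears on the path built for the tail, cut the path there.
module _ {A : Set} (_≟_ : DecidableEquality A) where

  Star⇒path : ∀ {R : A → A → Set} {x y} → Star R x y → x ≢ y →
              ∃ λ ys → Unique (x ∷ (ys ∷ʳ y)) × Linked R (x ∷ (ys ∷ʳ y))
  Star⇒path ε x≢y = ⊥-elim (x≢y refl)
  Star⇒path {x = x} {y} (_◅_ {j = w} r w⋆y) x≢y with w ≟ y
  ... | yes refl = [] , ((x≢y All.∷ All.[]) ∷ All.[] ∷ []) , r ∷ [-]
  ... | no w≢y with Star⇒path w⋆y w≢y
  ...   | ys , u , l with member? _≟_ x (w ∷ ys)
  ...     | no x∉ = w ∷ ys , AllP.¬Any⇒All¬ _ x∉path ∷ u , r ∷ l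
    where
    x∉path : x ∉ (w ∷ ys) ∷ʳ y
    x∉path p with MP.∈-++⁻ (w ∷ ys) p
    ... | inj₁ q        = x∉ q
    ... | inj₂ (here q) = x≢y q
  ...     | yes x∈ with MP.∈-∃++ x∈
  ...       | as , bs , eq = bs , Unique-++⁻ʳ as (subst Unique split u) ,
                                   Linked-++⁻ʳ as (subst (Linked _) split l)
    where
    split : (w ∷ ys) ∷ʳ y ≡ as ++ x ∷ (bs ∷ʳ y)
    split = trans (cong (_++ [ y ]) eq) (LP.++-assoc as (x ∷ bs) [ y ])

count : ∀ {k} {P : Pred (Fin k) 0ℓ} → Decidable P → ℕ
count {zero}  P? = 0
count {suc k} P? with P? F.zero
... | yes _ = suc (count (P? ∘ F.suc))
... | no  _ = count (P? ∘ F.suc)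

count-all : ∀ {k} {P : Pred (Fin k) 0ℓ} (P? : Decidable P) → (∀ z → P z) → count P? ≡ k
count-all {zero}  P? all = refl
count-all {suc k} P? all with P? F.zero
... | yes _ = cong suc (count-all (P? ∘ F.suc) (all ∘ F.suc))
... | no ¬p = ⊥-elim (¬p (all F.zero))

count-pos : ∀ {k} {P : Pred (Fin k) 0ℓ} (P? : Decidable P) {p} → P p → 0 < count P?
count-pos {suc k} P? {p} Pp with P? F.zero
... | yes _ = s≤s z≤n
count-pos {suc k} P? {F.zero}  Pp | no ¬p = ⊥-elim (¬p Pp)
count-pos {suc k} P? {F.suc p} Pp | no _  = count-pos (P? ∘ F.suc) Pp

count-cong : ∀ {k} {P Q : Pred (Fin k) 0ℓ} (P? : Decidable P) (Q? : Decidable Q) →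
             (∀ z → P z ⇔ Q z) → count P? ≡ count Q?
count-cong {zero}  P? Q? P⇔Q = refl
count-cong {suc k} P? Q? P⇔Q with P? F.zero | Q? F.zero
... | yes _  | yes _  = cong suc (count-cong (P? ∘ F.suc) (Q? ∘ F.suc) (P⇔Q ∘ F.suc))
... | no _   | no _   = count-cong (P? ∘ F.suc) (Q? ∘ F.suc) (P⇔Q ∘ F.suc)
... | yes P0 | no ¬Q0 = ⊥-elim (¬Q0 (Equivalence.to (P⇔Q F.zero) P0))
... | no ¬P0 | yes Q0 = ⊥-elim (¬P0 (Equivalence.from (P⇔Q F.zero) Q0))

count-remove : ∀ {k} {P Q : Pred (Fin k) 0ℓ} (P? : Decidable P) (Q? : Decidable Q) {p} →
               P p → ¬ Q p → (∀ z → z ≢ p → P z ⇔ Q z) → count P? ≡ suc (count Q?)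
count-remove {suc k} P? Q? {F.zero} Pp ¬Qp P⇔Q with P? F.zero | Q? F.zero
... | no ¬P0 | _     = ⊥-elim (¬P0 Pp)
... | yes _  | yes Q0 = ⊥-elim (¬Qp Q0)
... | yes _  | no _   = cong suc (count-cong (P? ∘ F.suc) (Q? ∘ F.suc) (λ z → P⇔Q (F.suc z) λ ()))
count-remove {suc k} P? Q? {F.suc p} Pp ¬Qp P⇔Q
  with P? F.zero | Q? F.zero
     | count-remove (P? ∘ F.suc) (Q? ∘ F.suc) Pp ¬Qp (λ z z≢p → P⇔Q (F.suc z) (z≢p ∘ FP.suc-injective))
... | yes _  | yes _  | tail = cong suc tail
... | no _   | no _   | tail = tail
... | yes P0 | no ¬Q0 | _    = ⊥-elim (¬Q0 (Equivalence.to (P⇔Q F.zero λ ()) P0))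
... | no ¬P0 | yes Q0 | _    = ⊥-elim (¬P0 (Equivalence.from (P⇔Q F.zero λ ()) Q0))

roots : ∀ {n} → (Fin n → Fin n) → ℕ
roots lab = count (λ x → lab x FP.≟ x)

-- The union–find step merging the classes of a and b.
module Merge {n} (lab : Fin n → Fin n) (idem : ∀ x → lab (lab x) ≡ lab x)
             (a b : Fin n) (a≁b : lab a ≢ lab b) where

  merged : Fin n → Fin n
  merged z with lab z FP.≟ lab b
  ... | yes _ = lab a
  ... | no  _ = lab z

  merged-class : ∀ {z} → lab z ≡ lab b → merged z ≡ lab a
  merged-class {z} p with lab z FP.≟ lab b
  ... | yes _ = refl
  ... | no ¬p = ⊥-elim (¬p p)

  merged-other : ∀ {z} → lab z ≢ lab b → merged z ≡ lab z
  merged-other {z} ¬p with lab z FP.≟ lab b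
  ... | yes p = ⊥-elim (¬p p)
  ... | no  _ = refl

  merged-label : ∀ {z} → lab z ≢ lab b → merged (lab z) ≡ lab z
  merged-label {z} ¬p = trans (merged-other (λ q → ¬p (trans (sym (idem z)) q))) (idem z)

  merged-idem : ∀ z → merged (merged z) ≡ merged z
  merged-idem z with lab z FP.≟ lab b
  ... | yes _ = merged-label a≁b
  ... | no ¬p = merged-label ¬p

  merged-≡ : ∀ {x y} → merged x ≡ merged y →
             lab x ≡ lab y ⊎ (lab x ≡ lab b × lab a ≡ lab y) ⊎ (lab x ≡ lab a × lab b ≡ lab y)
  merged-≡ {x} {y} eq with lab x FP.≟ lab b | lab y FP.≟ lab b
  ... | yes px | yes py = inj₁ (trans px (sym py))
  ... | yes px | no  _  = inj₂ (inj₁ (px , eq))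
  ... | no  _  | yes py = inj₂ (inj₂ (eq , sym py))
  ... | no  _  | no  _  = inj₁ eq

  roots-merged : roots lab ≡ suc (roots merged)
  roots-merged = count-remove (λ x → lab x FP.≟ x) (λ x → merged x FP.≟ x) (idem b)
                   (λ q → a≁b (trans (sym (merged-class (idem b))) q)) same-roots
    where
    same-roots : ∀ z → z ≢ lab b → (lab z ≡ z) ⇔ (merged z ≡ z)
    same-roots z z≢ with lab z FP.≟ lab b
    ... | no _  = mk⇔ id id
    ... | yes p = mk⇔ (λ q → ⊥-elim (z≢ (trans (sym q) p)))
                      (λ q → ⊥-elim (a≁b (trans (sym (idem a)) (trans (cong lab q) p))))

module EdgesOf {n : ℕ} (G : FinGraph n) where

  src tgt : Edge G → Fin n
  src (i , _) = i
  tgt (_ , j , _) = j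

  Edge-≡ : ∀ {e f : Edge G} → src e ≡ src f → tgt e ≡ tgt f → e ≡ f
  Edge-≡ {i , j , p , q} {.i , .j , p′ , q′} refl refl =
    cong₂ (λ p q → i , j , p , q) (FP.<-irrelevant p p′) (BP.T-irrelevant q q′)

  _≟ᴱ_ : DecidableEquality (Edge G)
  e ≟ᴱ f with src e FP.≟ src f | tgt e FP.≟ tgt f
  ... | yes s | yes t = yes (Edge-≡ s t)
  ... | no ¬s | _     = no (¬s ∘ cong src)
  ... | yes _ | no ¬t = no (¬t ∘ cong tgt)

  adj-irrefl : ∀ {a b} → T (adj G a b) → a ≢ b
  adj-irrefl {a} q refl = Adj-irrefl (toGraph G) q

  adj-sym′ : ∀ {a b} → T (adj G a b) → T (adj G b a)
  adj-sym′ = Adj-sym (toGraph G)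

  Joins : Edge G → Fin n → Fin n → Set
  Joins e a b = (src e ≡ a × tgt e ≡ b) ⊎ (src e ≡ b × tgt e ≡ a)

  joins-sym : ∀ {e a b} → Joins e a b → Joins e b a
  joins-sym (inj₁ st) = inj₂ st
  joins-sym (inj₂ st) = inj₁ st

  joins-injective : ∀ {e f a b} → Joins e a b → Joins f a b → e ≡ f
  joins-injective (inj₁ (s , t)) (inj₁ (s′ , t′)) = Edge-≡ (trans s (sym s′)) (trans t (sym t′))
  joins-injective (inj₂ (s , t)) (inj₂ (s′ , t′)) = Edge-≡ (trans s (sym s′)) (trans t (sym t′))
  joins-injective {_ , _ , p , _} {_ , _ , p′ , _} (inj₁ (refl , refl)) (inj₂ (refl , refl)) =
    ⊥-elim (FP.<-asym p p′)
  joins-injective {_ , _ , p , _} {_ , _ , p′ , _} (inj₂ (refl , refl)) (inj₁ (refl , refl)) =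
    ⊥-elim (FP.<-asym p p′)

  joins-functional : ∀ {e a b b′} → Joins e a b → Joins e a b′ → b ≡ b′
  joins-functional (inj₁ (s , t)) (inj₁ (s′ , t′)) = trans (sym t) t′
  joins-functional (inj₁ (s , t)) (inj₂ (s′ , t′)) = trans (sym t) (trans t′ (trans (sym s) s′))
  joins-functional (inj₂ (s , t)) (inj₁ (s′ , t′)) = trans (sym s) (trans s′ (trans (sym t) t′))
  joins-functional (inj₂ (s , t)) (inj₂ (s′ , t′)) = trans (sym s) s′

  joins⇒incident : ∀ {e a b} → Joins e a b → Incident {G = G} a e × Incident {G = G} b e
  joins⇒incident (inj₁ (s , t)) = inj₁ (sym s) , inj₂ (sym t)
  joins⇒incident (inj₂ (s , t)) = inj₂ (sym t) , inj₁ (sym s)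

  incident⇒endpoint : ∀ {v e a b} → Incident {G = G} v e → Joins e a b → v ≡ a ⊎ v ≡ b
  incident⇒endpoint (inj₁ p) (inj₁ (s , t)) = inj₁ (trans p s)
  incident⇒endpoint (inj₁ p) (inj₂ (s , t)) = inj₂ (trans p s)
  incident⇒endpoint (inj₂ p) (inj₁ (s , t)) = inj₂ (trans p t)
  incident⇒endpoint (inj₂ p) (inj₂ (s , t)) = inj₁ (trans p t)

  joins⇒adj : ∀ {e a b} → Joins e a b → T (adj G a b)
  joins⇒adj {_ , _ , _ , q} (inj₁ (refl , refl)) = q
  joins⇒adj {_ , _ , _ , q} (inj₂ (refl , refl)) = adj-sym′ q

  edgeBetween : ∀ {a b} → T (adj G a b) → Σ (Edge G) λ e → Joins e a b
  edgeBetween {a} {b} q with FP.<-cmp a b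
  ... | tri< a<b _ _ = (a , b , a<b , q) , inj₁ (refl , refl)
  ... | tri≈ _ a≡b _ = ⊥-elim (adj-irrefl q a≡b)
  ... | tri> _ _ b<a = (b , a , b<a , adj-sym′ q) , inj₂ (refl , refl)

  edgesAt : Fin n × Fin n → List (Edge G)
  edgesAt (i , j) with i F.<? j | BP.T? (adj G i j)
  ... | yes i<j | yes q = [ i , j , i<j , q ]
  ... | _       | _     = []

  edges : List (Edge G)
  edges = deduplicate _≟ᴱ_ (concatMap edgesAt (cartesianProduct (allFin n) (allFin n)))

  ∈-edges : ∀ e → e ∈ edges
  ∈-edges e@(i , j , i<j , q) = MP.∈-deduplicate⁺ _≟ᴱ_ (MP.∈-concatMap⁺ edgesAt
    (lose (MP.∈-cartesianProduct⁺ (MP.∈-allFin i) (MP.∈-allFin j)) ∈-edgesAt))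
    where
    ∈-edgesAt : e ∈ edgesAt (i , j)
    ∈-edgesAt with i F.<? j | BP.T? (adj G i j)
    ... | yes _   | yes _ = here (Edge-≡ refl refl)
    ... | yes _   | no ¬q = ⊥-elim (¬q q)
    ... | no ¬i<j | _     = ⊥-elim (¬i<j i<j)

  edges-unique : Unique edges
  edges-unique = UDP.deduplicate-! _≟ᴱ_ _

module Forest {n} (G : FinGraph n) (acyclic : Acyclic (toGraph G)) where
  open EdgesOf G

  JoinedBy : List (Edge G) → Fin n → Fin n → Set
  JoinedBy L a b = Any (λ e → Joins e a b) L

  joinedBy⇒adj : ∀ {L x y} → JoinedBy L x y → T (adj G x y)
  joinedBy⇒adj x~y = let f , _ , joins = find x~y in joins⇒adj {f} joins

  -- label sends each vertex to a chosen representative of its component in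
  -- (Fin n, L), so roots label is the number of components.
  record Components (L : List (Edge G)) : Set where
    field
      label        : Fin n → Fin n
      label-idem   : ∀ x → label (label x) ≡ label x
      label-walk   : ∀ {x y} → label x ≡ label y → Star (JoinedBy L) x y
      roots+length : roots label + length L ≡ n

  discrete : Components []
  discrete = record
    { label        = id
    ; label-idem   = λ _ → refl
    ; label-walk   = λ { refl → ε }
    ; roots+length = trans (ℕP.+-identityʳ _) (count-all (λ x → x FP.≟ x) (λ _ → refl))
    }

  add-edge : ∀ {e L} → e ∉ L → Components L → Components (e ∷ L)
  add-edge {e} {L} e∉L C = record
    { label        = merged
    ; label-idem   = merged-idem
    ; label-walk   = walk
    ; roots+length = trans (ℕP.+-suc _ _) (trans (cong (_+ length L) (sym roots-merged)) roots+length)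
    }
    where
    open Components C
    a b : Fin n
    a = src e
    b = tgt e
    e-joins : Joins e a b
    e-joins = inj₁ (refl , refl)

    -- Otherwise a path from a to b in L, closed by e, would be a cycle.
    separated : label a ≢ label b
    separated eq with Star⇒path FP._≟_ (label-walk eq) (adj-irrefl (joins⇒adj {e} e-joins))
    ... | [] , _ , (a~b ∷ [-]) with find a~b
    ...   | f , f∈L , f-joins = e∉L (subst (_∈ L) (joins-injective f-joins e-joins) f∈L)
    separated eq | y ∷ ys , unique , linked =
      acyclic a (y ∷ ys) b
        (unique , s≤s z≤n , Lk.map joinedBy⇒adj linked , joins⇒adj {e} (joins-sym {e} e-joins))

    open Merge label label-idem a b separated

    grow : ∀ {x y} → Star (JoinedBy L) x y → Star (JoinedBy (e ∷ L)) x y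
    grow = Star.map there

    walk : ∀ {x y} → merged x ≡ merged y → Star (JoinedBy (e ∷ L)) x y
    walk eq with merged-≡ eq
    ... | inj₁ same = grow (label-walk same)
    ... | inj₂ (inj₁ (x~b , a~y)) =
      grow (label-walk x~b) ◅◅ (here (joins-sym {e} e-joins) ◅ grow (label-walk a~y))
    ... | inj₂ (inj₂ (x~a , b~y)) =
      grow (label-walk x~a) ◅◅ (here e-joins ◅ grow (label-walk b~y))

  components : ∀ L → Unique L → Components L
  components []      _       = discrete
  components (e ∷ L) (e∉ ∷ u) = add-edge (AllP.All¬⇒¬Any e∉) (components L u)

forest-edges≤ : ∀ {m} (G : FinGraph (suc m)) → Acyclic (toGraph G) →
                ∀ {L : List (Edge G)} → Unique L → length L ≤ m
forest-edges≤ G acyclic {L} u = ℕP.≤-pred (subst (suc (length L) ≤_) roots+length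
  (ℕP.+-monoˡ-≤ (length L) (count-pos (λ x → label x FP.≟ x) (label-idem F.zero))))
  where open Forest.Components (Forest.components G acyclic L u)

walk-head : ∀ {V} {H : Graph V} {P : V → Set} {x y} → WalkIn H P x y → P x
walk-head (here p)     = p
walk-head (step p _ _) = p

module MiddleOf {n} (G : FinGraph n) where
  open EdgesOf G

  _≟ᴹ_ : DecidableEquality (Fin n ⊎ Edge G)
  _≟ᴹ_ = SP.≡-dec FP._≟_ _≟ᴱ_

  middleVertices : List (Fin n ⊎ Edge G)
  middleVertices = map inj₁ (allFin n) ++ map inj₂ edges

  ∈-middleVertices : ∀ z → z ∈ middleVertices
  ∈-middleVertices (inj₁ x) = MP.∈-++⁺ˡ (MP.∈-map⁺ inj₁ (MP.∈-allFin x))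
  ∈-middleVertices (inj₂ e) = MP.∈-++⁺ʳ _ (MP.∈-map⁺ inj₂ (∈-edges e))

  middleVertices-unique : Unique middleVertices
  middleVertices-unique =
    UP.++⁺ (UP.map⁺ SP.inj₁-injective (UP.allFin⁺ n)) (UP.map⁺ SP.inj₂-injective edges-unique)
           disjoint
    where
    disjoint : ∀ {z} → ¬ (z ∈ map inj₁ (allFin n) × z ∈ map inj₂ edges)
    disjoint (p , q) with MP.∈-map⁻ inj₁ p | MP.∈-map⁻ inj₂ q
    ... | _ , _ , refl | _ , _ , ()

  length-middleVertices : length middleVertices ≡ n + length edges
  length-middleVertices = begin
    length middleVertices
      ≡⟨ LP.length-++ (map inj₁ (allFin n)) ⟩
    length (map inj₁ (allFin n)) + length (map inj₂ edges)
      ≡⟨ cong₂ _+_ (LP.length-map inj₁ (allFin n)) (LP.length-map inj₂ edges) ⟩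
    length (allFin n) + length edges
      ≡⟨ cong (_+ length edges) (LP.length-tabulate {n = n} id) ⟩
    n + length edges
      ∎
    where open ≡-Reasoning

  sole-edge∈ : ∀ {D j f} → IsTotalDominating (Middle G) D →
               (∀ g → Incident {G = G} j g → g ≡ f) → inj₂ f ∈ D
  sole-edge∈ {D} {j} dom sole with dom (inj₁ j)
  ... | inj₂ g , g∈D , j∈g = subst (λ h → inj₂ h ∈ D) (sole g j∈g) g∈D

  edges⊆⇒one-vertex-outside : ∀ {D} → IsTOCDS (Middle G) D → (∀ f → inj₂ f ∈ D) →
                              ∀ {x y} → inj₁ x ∉ D → inj₁ y ∉ D → x ≡ y
  edges⊆⇒one-vertex-outside {D} (_ , _ , outer) edges⊆ x∉ y∉ =
    sym (SP.inj₁-injective (stays (outer _ _ x∉ y∉)))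
    where
    stays : ∀ {x z} → WalkIn (Middle G) (_∉ D) (inj₁ x) z → z ≡ inj₁ x
    stays (here _)                  = refl
    stays (step {y = inj₂ g} _ _ g⋯) = ⊥-elim (walk-head g⋯ (edges⊆ g))

record StarCentre {n} (G : FinGraph n) (c : Fin n) : Set where
  field
    adj-centre    : ∀ {j} → j ≢ c → T (adj G c j)
    nonadj-leaves : ∀ {i j} → i ≢ c → j ≢ c → ¬ T (adj G i j)

isZero≡false : ∀ {n} {y : Fin (suc n)} → y ≢ F.zero → isZero y ≡ false
isZero≡false {y = F.zero}  y≢0 = ⊥-elim (y≢0 refl)
isZero≡false {y = F.suc _} _   = refl

IsoToStar⇔StarCentre : ∀ {m} (G : FinGraph (suc m)) → IsoToStar G ⇔ ∃ (StarCentre G)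
IsoToStar⇔StarCentre {m} G = mk⇔ centre isomorphism
  where
  centre : IsoToStar G → ∃ (StarCentre G)
  centre (f , adj≡) = c , record
    { adj-centre    = λ j≢c → BP.T-≡ .Equivalence.from
                        (trans (adj≡ c _) (cong₂ _xor_ (cong isZero (strictlyInverseˡ F.zero)) (leaf j≢c)))
    ; nonadj-leaves = λ i≢c j≢c → subst T (trans (adj≡ _ _) (cong₂ _xor_ (leaf i≢c) (leaf j≢c)))
    }
    where
    open Inverse f
    c = from F.zero
    leaf : ∀ {x} → x ≢ c → isZero (to x) ≡ false
    leaf {x} x≢c = isZero≡false λ eq → x≢c (trans (sym (strictlyInverseʳ x)) (cong from eq))

  isomorphism : ∃ (StarCentre G) → IsoToStar G
  isomorphism (c , star) = swap , adj≡
    where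
    open StarCentre star
    swap : Fin (suc m) ↔ Fin (suc m)
    swap = Perm.transpose c F.zero
    isZero-swap : ∀ x → isZero (Inverse.to swap x) ≡ does (x FP.≟ c)
    isZero-swap x with x FP.≟ c
    ... | yes _ = refl
    ... | no x≢c with x FP.≟ F.zero
    ...   | yes refl = isZero≡false (x≢c ∘ sym)
    ...   | no x≢0   = isZero≡false x≢0
    adj≡ : ∀ i j → adj G i j ≡ StarAdj (Inverse.to swap i) (Inverse.to swap j)
    adj≡ i j rewrite isZero-swap i | isZero-swap j with i FP.≟ c | j FP.≟ c
    ... | yes refl | yes refl = adj-irr G c
    ... | yes refl | no j≢c   = BP.T-≡ .Equivalence.to (adj-centre j≢c)
    ... | no i≢c   | yes refl = BP.T-≡ .Equivalence.to (subst T (adj-sym G c i) (adj-centre i≢c))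
    ... | no i≢c   | no j≢c   = BP.¬-not (nonadj-leaves i≢c j≢c ∘ BP.T-≡ .Equivalence.from)

NoIsolated : ∀ {n} → FinGraph n → Set
NoIsolated {n} G = ∀ (w : Fin n) → ∃ λ t → T (adj G w t)

Pendant : ∀ {n} (G : FinGraph n) → Edge G → Set
Pendant {n} G f =
  ∃ λ (j : Fin n) → Incident {G = G} j f × ∀ g → Incident {G = G} j g → g ≡ f

module AllBut {m} (G : FinGraph (suc m)) where
  open EdgesOf G
  open MiddleOf G

  otherVertices : Fin (suc m) → List (Fin (suc m) ⊎ Edge G)
  otherVertices x = map (inj₁ ∘ F.punchIn x) (allFin m)

  allBut : Fin (suc m) → List (Fin (suc m) ⊎ Edge G)
  allBut x = otherVertices x ++ map inj₂ edges

  ∈-allBut : ∀ {x z} → z ≢ inj₁ x → z ∈ allBut x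
  ∈-allBut {x} {inj₁ y} y≢x = MP.∈-++⁺ˡ
    (subst (_∈ otherVertices x) (cong inj₁ (FP.punchIn-punchOut x≢y))
           (MP.∈-map⁺ (inj₁ ∘ F.punchIn x) (MP.∈-allFin (F.punchOut x≢y))))
    where
    x≢y : x ≢ y
    x≢y x≡y = y≢x (cong inj₁ (sym x≡y))
  ∈-allBut {x} {inj₂ e} _ = MP.∈-++⁺ʳ _ (MP.∈-map⁺ inj₂ (∈-edges e))

  ∉-allBut : ∀ {x z} → z ∈ allBut x → z ≢ inj₁ x
  ∉-allBut {x} z∈ refl with MP.∈-++⁻ (otherVertices x) z∈
  ... | inj₁ p with MP.∈-map⁻ (inj₁ ∘ F.punchIn x) p
  ...   | k , _ , eq = FP.punchInᵢ≢i x k (sym (SP.inj₁-injective eq))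
  ∉-allBut z∈ refl | inj₂ p with MP.∈-map⁻ inj₂ p
  ...   | _ , _ , ()

  allBut-unique : ∀ x → Unique (allBut x)
  allBut-unique x = UP.++⁺ (UP.map⁺ (FP.punchIn-injective x _ _ ∘ SP.inj₁-injective) (UP.allFin⁺ m))
                           (UP.map⁺ SP.inj₂-injective edges-unique)
                           disjoint
    where
    disjoint : ∀ {z} → ¬ (z ∈ otherVertices x × z ∈ map inj₂ edges)
    disjoint (p , q) with MP.∈-map⁻ (inj₁ ∘ F.punchIn x) p | MP.∈-map⁻ inj₂ q
    ... | _ , _ , refl | _ , _ , ()

  length-allBut : ∀ x → length (allBut x) ≡ m + length edges
  length-allBut x = begin
    length (allBut x)
      ≡⟨ LP.length-++ (otherVertices x) ⟩
    length (otherVertices x) + length (map inj₂ edges)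
      ≡⟨ cong₂ _+_ (LP.length-map _ (allFin m)) (LP.length-map inj₂ edges) ⟩
    length (allFin m) + length edges
      ≡⟨ cong (_+ length edges) (LP.length-tabulate {n = m} id) ⟩
    m + length edges
      ∎
    where open ≡-Reasoning

  allBut-TOCDS : NoIsolated G → ∀ x → IsTOCDS (Middle G) (allBut x)
  allBut-TOCDS no-isolated x = allBut-unique x , dominating , outer-connected
    where
    dominating : IsTotalDominating (Middle G) (allBut x)
    dominating (inj₁ w) with edgeBetween (proj₂ (no-isolated w))
    ... | e , e-joins = inj₂ e , ∈-allBut (λ ()) , proj₁ (joins⇒incident {e} e-joins)
    dominating (inj₂ (i , j , i<j , _)) with i FP.≟ x
    ... | yes refl = inj₁ j , ∈-allBut (FP.<⇒≢ i<j ∘ sym ∘ SP.inj₁-injective) , inj₂ refl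
    ... | no i≢x   = inj₁ i , ∈-allBut (i≢x ∘ SP.inj₁-injective) , inj₁ refl
    outer-connected : ∀ y z → y ∉ allBut x → z ∉ allBut x → WalkIn (Middle G) (_∉ allBut x) y z
    outer-connected y z y∉ z∉ =
      subst (WalkIn (Middle G) (_∉ allBut x) y) (trans (is-x y∉) (sym (is-x z∉))) (here y∉)
      where
      is-x : ∀ {z} → z ∉ allBut x → z ≡ inj₁ x
      is-x {z} z∉ = decidable-stable (z ≟ᴹ inj₁ x) (z∉ ∘ ∈-allBut)

  -- Pendant edges lie in every total dominating set, and then the vertices of
  -- G outside a TOCDS cannot reach anything but themselves.
  pendant⇒allBut⊆ : (∀ f → Pendant G f) → ∀ {D} → IsTOCDS (Middle G) D →
                    ∃ λ x → allBut x ⊆ D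
  pendant⇒allBut⊆ pendant {D} tocds@(_ , dominating , _) =
    x , λ z∈ → others∈D (∉-allBut z∈)
    where
    edges⊆D : ∀ f → inj₂ f ∈ D
    edges⊆D f = let _ , _ , sole = pendant f in sole-edge∈ dominating sole
    outside : ∃ λ x → ∀ y → y ≢ x → inj₁ y ∈ D
    outside with FP.any? (λ x → ¬? (member? _≟ᴹ_ (inj₁ x) D))
    ... | yes (x , x∉) = x , λ y y≢x → decidable-stable (member? _≟ᴹ_ (inj₁ y) D)
                              (y≢x ∘ sym ∘ edges⊆⇒one-vertex-outside tocds edges⊆D x∉)
    ... | no none      = F.zero , λ y _ → decidable-stable (member? _≟ᴹ_ (inj₁ y) D)
                              (λ y∉ → none (y , y∉))
    x : Fin (suc m)
    x = proj₁ outside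
    others∈D : ∀ {z} → z ≢ inj₁ x → z ∈ D
    others∈D {inj₁ y} y≢x = proj₂ outside y (y≢x ∘ cong inj₁)
    others∈D {inj₂ f} _   = edges⊆D f

  pendant⇒γtc : NoIsolated G → (∀ f → Pendant G f) → γtc-is (Middle G) (m + length edges)
  pendant⇒γtc no-isolated pendant =
    (allBut F.zero , allBut-TOCDS no-isolated F.zero , length-allBut F.zero) ,
    λ D tocds → let x , allBut⊆D = pendant⇒allBut⊆ pendant tocds in
      subst (_≤ length D) (length-allBut x) (Unique⇒length≤ (allBut-unique x) allBut⊆D)

module StarGraph {m} {G : FinGraph (suc m)} {c : Fin (suc m)} (star : StarCentre G c) where
  open StarCentre star
  open EdgesOf G

  no-isolated : ∀ {j₀} → j₀ ≢ c → NoIsolated G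
  no-isolated {j₀} j₀≢c w with w FP.≟ c
  ... | yes refl = j₀ , adj-centre j₀≢c
  ... | no w≢c   = c , adj-sym′ (adj-centre w≢c)

  edge-leaf : ∀ f → ∃ λ j → j ≢ c × Joins f c j
  edge-leaf (i , j , i<j , q) with i FP.≟ c | j FP.≟ c
  ... | yes refl | _        = j , (λ j≡i → FP.<-irrefl (sym j≡i) i<j) , inj₁ (refl , refl)
  ... | no i≢c   | yes refl = i , i≢c , inj₂ (refl , refl)
  ... | no i≢c   | no j≢c   = ⊥-elim (nonadj-leaves i≢c j≢c q)

  pendant : ∀ f → Pendant G f
  pendant f with edge-leaf f
  ... | j , j≢c , f-joins = j , proj₂ (joins⇒incident {f} f-joins) , sole
    where
    sole : ∀ g → Incident {G = G} j g → g ≡ f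
    sole g j∈g with edge-leaf g
    ... | _ , _ , g-joins with incident⇒endpoint {j} {g} j∈g g-joins
    ...   | inj₁ j≡c  = ⊥-elim (j≢c j≡c)
    ...   | inj₂ refl = joins-injective g-joins f-joins

  spoke : Fin m → Edge G
  spoke k = proj₁ (edgeBetween (adj-centre (FP.punchInᵢ≢i c k)))

  spoke-joins : ∀ k → Joins (spoke k) c (F.punchIn c k)
  spoke-joins k = proj₂ (edgeBetween (adj-centre (FP.punchInᵢ≢i c k)))

  spokes : List (Edge G)
  spokes = map spoke (allFin m)

  edges⊆spokes : edges ⊆ spokes
  edges⊆spokes {f} _ with edge-leaf f
  ... | j , j≢c , f-joins = subst (_∈ spokes) (joins-injective (spoke-joins k) k-joins)
                              (MP.∈-map⁺ spoke (MP.∈-allFin k))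
    where
    k : Fin m
    k = F.punchOut (j≢c ∘ sym)
    k-joins : Joins f c (F.punchIn c k)
    k-joins = subst (Joins f c) (sym (FP.punchIn-punchOut _)) f-joins

  spokes-unique : Unique spokes
  spokes-unique = UP.map⁺ spoke-injective (UP.allFin⁺ m)
    where
    spoke-injective : ∀ {k k′} → spoke k ≡ spoke k′ → k ≡ k′
    spoke-injective {k} {k′} eq = FP.punchIn-injective c k k′
      (joins-functional {spoke k} (spoke-joins k)
        (subst (λ e → Joins e c _) (sym eq) (spoke-joins k′)))

  length-edges : length edges ≡ m
  length-edges = ℕP.≤-antisym
    (subst (length edges ≤_) length-spokes (Unique⇒length≤ edges-unique edges⊆spokes))
    (subst (_≤ length edges) length-spokes (Unique⇒length≤ spokes-unique λ {f} _ → ∈-edges f))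
    where
    length-spokes : length spokes ≡ m
    length-spokes = trans (LP.length-map spoke (allFin m)) (LP.length-tabulate {n = m} id)

  γtc-middle : ∀ {j₀} → j₀ ≢ c → γtc-is (Middle G) (m + m)
  γtc-middle j₀≢c = subst (λ k → γtc-is (Middle G) (m + k)) length-edges
    (AllBut.pendant⇒γtc G (no-isolated j₀≢c) pendant)

NeighbourBesides : ∀ {n} → FinGraph n → Fin n → Fin n → Set
NeighbourBesides {n} G u v = ∃ λ (w : Fin n) → w ≢ v × T (adj G u w)

-- D is M(G) minus e = uv and u: u and v stay dominated through their other
-- edges, and the complement {e, u} is connected.
internal-edge⇒small-TOCDS : ∀ {m} (G : FinGraph (suc m)) → NoIsolated G → Acyclic (toGraph G) →
  ∀ {u v} → T (adj G u v) → NeighbourBesides G u v → NeighbourBesides G v u →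
  ∃ λ D → IsTOCDS (Middle G) D × length D < m + m
internal-edge⇒small-TOCDS {m} G no-isolated acyclic {u} {v} u~v
                          (u′ , u′≢v , u~u′) (v′ , v′≢u , v~v′) =
  D , (unique , dominating , outer-connected) , shorter
  where
  open EdgesOf G
  open MiddleOf G
  e : Edge G
  e = proj₁ (edgeBetween u~v)
  e-joins : Joins e u v
  e-joins = proj₂ (edgeBetween u~v)
  u∈e : Incident {G = G} u e
  u∈e = proj₁ (joins⇒incident {e} e-joins)

  not-e? : Decidable (_≢ inj₂ e)
  not-e? z = ¬? (z ≟ᴹ inj₂ e)
  not-u? : Decidable (_≢ inj₁ u)
  not-u? z = ¬? (z ≟ᴹ inj₁ u)

  D₁ D : List (Fin (suc m) ⊎ Edge G)
  D₁ = filter not-e? middleVertices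
  D  = filter not-u? D₁

  ∈D : ∀ {z} → z ≢ inj₂ e → z ≢ inj₁ u → z ∈ D
  ∈D {z} z≢e z≢u = MP.∈-filter⁺ not-u? (MP.∈-filter⁺ not-e? (∈-middleVertices z) z≢e) z≢u

  unique : Unique D
  unique = UP.filter⁺ not-u? (UP.filter⁺ not-e? middleVertices-unique)

  shorter : length D < m + m
  shorter = ℕP.≤-pred (begin-strict
    suc (length D)         <⟨ s≤s (LP.filter-notAll not-u? D₁ (lose u∈D₁ (λ z → z refl))) ⟩
    suc (length D₁)        ≤⟨ LP.filter-notAll not-e? middleVertices (lose e∈ (λ z → z refl)) ⟩
    length middleVertices  ≡⟨ length-middleVertices ⟩
    suc m + length edges   ≤⟨ ℕP.+-monoʳ-≤ (suc m) (forest-edges≤ G acyclic edges-unique) ⟩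
    suc (m + m)            ∎)
    where
    open ℕP.≤-Reasoning
    u∈D₁ : inj₁ u ∈ D₁
    u∈D₁ = MP.∈-filter⁺ not-e? (∈-middleVertices (inj₁ u)) (λ ())
    e∈ : inj₂ e ∈ middleVertices
    e∈ = ∈-middleVertices (inj₂ e)

  dominated-by : ∀ {w t} → T (adj G w t) → (∀ {f} → Joins f w t → f ≢ e) →
                 ∃ λ d → d ∈ D × Adj (Middle G) (inj₁ w) d
  dominated-by w~t f≢e with edgeBetween w~t
  ... | f , f-joins =
    inj₂ f , ∈D (f≢e f-joins ∘ SP.inj₂-injective) (λ ()) , proj₁ (joins⇒incident {f} f-joins)

  besides-e : ∀ {w t w′} → Joins e w w′ → t ≢ w′ → ∀ {f} → Joins f w t → f ≢ e
  besides-e e-joins′ t≢w′ f-joins refl = t≢w′ (joins-functional {e} f-joins e-joins′)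

  dominating : IsTotalDominating (Middle G) D
  dominating (inj₁ w) with w FP.≟ u | w FP.≟ v
  ... | yes refl | _        = dominated-by u~u′ (besides-e e-joins u′≢v)
  ... | no _     | yes refl = dominated-by v~v′ (besides-e (joins-sym {e} e-joins) v′≢u)
  ... | no w≢u   | no w≢v   = dominated-by (proj₂ (no-isolated w)) away
    where
    away : ∀ {f t} → Joins f w t → f ≢ e
    away f-joins refl with incident⇒endpoint {w} {e} (proj₁ (joins⇒incident {e} f-joins)) e-joins
    ... | inj₁ w≡u = w≢u w≡u
    ... | inj₂ w≡v = w≢v w≡v
  dominating (inj₂ (a , b , a<b , _)) with a FP.≟ u
  ... | yes refl = inj₁ b , ∈D (λ ()) (FP.<⇒≢ a<b ∘ sym ∘ SP.inj₁-injective) , inj₂ refl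
  ... | no a≢u   = inj₁ a , ∈D (λ ()) (a≢u ∘ SP.inj₁-injective) , inj₁ refl

  outside : ∀ {z} → z ∉ D → z ≡ inj₂ e ⊎ z ≡ inj₁ u
  outside {z} z∉ with z ≟ᴹ inj₂ e | z ≟ᴹ inj₁ u
  ... | yes z≡e | _       = inj₁ z≡e
  ... | no _    | yes z≡u = inj₂ z≡u
  ... | no z≢e  | no z≢u  = ⊥-elim (z∉ (∈D z≢e z≢u))

  outer-connected : ∀ x y → x ∉ D → y ∉ D → WalkIn (Middle G) (_∉ D) x y
  outer-connected x y x∉ y∉ with outside x∉ | outside y∉
  ... | inj₁ refl | inj₁ refl = here x∉
  ... | inj₂ refl | inj₂ refl = here x∉
  ... | inj₁ refl | inj₂ refl = step x∉ u∈e (here y∉)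
  ... | inj₂ refl | inj₁ refl = step x∉ u∈e (here y∉)

walk-closed : ∀ {V} {H : Graph V} {P Q : V → Set} →
              (∀ {x y} → Q x → Adj H x y → Q y) → ∀ {x y} → WalkIn H P x y → Q x → Q y
walk-closed closed (here _)        Qx = Qx
walk-closed closed (step _ x~y y⋯) Qx = walk-closed closed y⋯ (closed Qx x~y)

neighbourBesides? : ∀ {n} (G : FinGraph n) u v → Dec (NeighbourBesides G u v)
neighbourBesides? G u v = FP.any? (λ w → ¬? (w FP.≟ v) ×-dec BP.T? (adj G u w))

only-neighbour : ∀ {n} (G : FinGraph n) {u v} → ¬ NeighbourBesides G u v →
                 ∀ {w} → T (adj G u w) → w ≡ v
only-neighbour G {v = v} none {w} u~w =
  decidable-stable (w FP.≟ v) (λ w≢v → none (w , w≢v , u~w))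

connected⇒no-isolated : ∀ {k} (G : FinGraph (2 + k)) → Connected (toGraph G) → NoIsolated G
connected⇒no-isolated G connected w = first-step (connected w (other w)) (other≢ w)
  where
  other : Fin (2 + _) → Fin (2 + _)
  other F.zero    = F.suc F.zero
  other (F.suc _) = F.zero
  other≢ : ∀ w → w ≢ other w
  other≢ F.zero    ()
  other≢ (F.suc _) ()
  first-step : ∀ {P x y} → WalkIn (toGraph G) P x y → x ≢ y → ∃ λ t → T (adj G x t)
  first-step (here _)       x≢x = ⊥-elim (x≢x refl)
  first-step (step _ x~t _) _   = _ , x~t

Branching : ∀ {n} → FinGraph n → Fin n → Set
Branching {n} G c =
  ∃ λ (w₁ : Fin n) → ∃ λ w₂ → w₁ ≢ w₂ × T (adj G c w₁) × T (adj G c w₂)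

-- Take a neighbour a of 0; if neither 0 nor a has a further neighbour, then
-- {0, a} is closed under adjacency, so a third vertex is unreachable.
connected⇒branching : ∀ {k} (G : FinGraph (3 + k)) → Connected (toGraph G) → ∃ (Branching G)
connected⇒branching G connected with connected⇒no-isolated G connected F.zero
... | a , 0~a with neighbourBesides? G F.zero a
...   | yes (w , w≢a , 0~w) = F.zero , a , w , w≢a ∘ sym , 0~a , 0~w
...   | no only-a with neighbourBesides? G a F.zero
...     | yes (w , w≢0 , a~w) = a , F.zero , w , w≢0 ∘ sym , Adj-sym (toGraph G) 0~a , a~w
...     | no only-0 = ⊥-elim (third∉ (walk-closed closed (connected F.zero third) (inj₁ refl)))
  where
  third : Fin (3 + _)
  third with a FP.≟ F.suc F.zero
  ... | yes _ = F.suc (F.suc F.zero)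
  ... | no  _ = F.suc F.zero
  third∉ : ¬ (third ≡ F.zero ⊎ third ≡ a)
  third∉ _ with a FP.≟ F.suc F.zero
  third∉ (inj₁ ())   | yes _
  third∉ (inj₂ refl) | yes ()
  third∉ (inj₁ ())   | no _
  third∉ (inj₂ eq)   | no a≢1 = a≢1 (sym eq)
  closed : ∀ {x y} → (x ≡ F.zero ⊎ x ≡ a) → T (adj G x y) → (y ≡ F.zero ⊎ y ≡ a)
  closed (inj₁ refl) x~y = inj₂ (only-neighbour G only-a x~y)
  closed (inj₂ refl) x~y = inj₁ (only-neighbour G only-0 x~y)

-- Each neighbour w of a branching vertex c is a leaf (else cw is an inner
-- edge), so walking from c never leaves the closed neighbourhood of c.
branching⇒star : ∀ {n} {G : FinGraph n} → Connected (toGraph G) →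
  (∀ {u v} → T (adj G u v) → NeighbourBesides G u v → NeighbourBesides G v u → ⊥) →
  ∀ {c} → Branching G c → StarCentre G c
branching⇒star {G = G} connected no-inner {c} (w₁ , w₂ , w₁≢w₂ , c~w₁ , c~w₂) = record
  { adj-centre    = adj-centre
  ; nonadj-leaves = λ i≢c j≢c i~j → j≢c (leaf (adj-centre i≢c) i~j)
  }
  where
  besides : ∀ w → NeighbourBesides G c w
  besides w with w FP.≟ w₁
  ... | yes refl = w₂ , w₁≢w₂ ∘ sym , c~w₂
  ... | no w≢w₁  = w₁ , w≢w₁ ∘ sym , c~w₁
  leaf : ∀ {w} → T (adj G c w) → ∀ {z} → T (adj G w z) → z ≡ c
  leaf {w} c~w with neighbourBesides? G w c
  ... | yes other = ⊥-elim (no-inner c~w (besides w) other)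
  ... | no only-c = only-neighbour G only-c
  near : ∀ {x y} → (x ≡ c ⊎ T (adj G c x)) → T (adj G x y) → (y ≡ c ⊎ T (adj G c y))
  near (inj₁ refl) x~y = inj₂ x~y
  near (inj₂ c~x)  x~y = inj₁ (leaf c~x x~y)
  adj-centre : ∀ {j} → j ≢ c → T (adj G c j)
  adj-centre {j} j≢c with walk-closed near (connected c j) (inj₁ refl)
  ... | inj₁ j≡c = ⊥-elim (j≢c j≡c)
  ... | inj₂ c~j = c~j

2n∸2≡m+m : ∀ m → 2 * suc m ∸ 2 ≡ m + m
2n∸2≡m+m m = begin
  2 * suc m ∸ 2            ≡⟨ cong (λ k → suc m + k ∸ 2) (ℕP.+-identityʳ (suc m)) ⟩
  suc m + suc m ∸ 2        ≡⟨ cong (_∸ 1) (ℕP.+-suc m m) ⟩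
  m + m                    ∎
  where open ≡-Reasoning

corollary3p5 : (n : ℕ) → 4 ≤ n → (T : FinGraph n) → IsTree (toGraph T) →
    (γtc-is (Middle T) (2 * n ∸ 2) ⇔ IsoToStar T)
corollary3p5 (suc m@(suc (suc (suc k)))) (s≤s (s≤s (s≤s (s≤s _)))) G (connected , acyclic) =
  subst (λ γ → γtc-is (Middle G) γ ⇔ IsoToStar G) (sym (2n∸2≡m+m m))
        (mk⇔ star-of-γtc γtc-of-star)
  where
  star-of-γtc : γtc-is (Middle G) (m + m) → IsoToStar G
  star-of-γtc (_ , minimal) with connected⇒branching G connected
  ... | c , branching = Equivalence.from (IsoToStar⇔StarCentre G)
                          (c , branching⇒star connected no-inner branching)
    where
    no-inner : ∀ {u v} → T (adj G u v) → NeighbourBesides G u v → NeighbourBesides G v u → ⊥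
    no-inner u~v u-other v-other =
      let D , tocds , shorter = internal-edge⇒small-TOCDS G (connected⇒no-isolated G connected)
                                  acyclic u~v u-other v-other
      in ℕP.<⇒≱ shorter (minimal D tocds)

  γtc-of-star : IsoToStar G → γtc-is (Middle G) (m + m)
  γtc-of-star iso with Equivalence.to (IsoToStar⇔StarCentre G) iso
  ... | c , star = StarGraph.γtc-middle star (FP.punchInᵢ≢i c F.zero)
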